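{- Let $d,n\geq 2$, let $1<a\leq n$ and $1\leq s\leq d-1$, and let $w=[1^{(0)}]_s[a^{(0)}]_{d-s}\in G(d,d,n)$, i.e. the element sending $1^{(t)}\mapsto 1^{(t+s)}$ and $a^{(t)}\mapsto a^{(t-s)}$ for all $t\in\mathbb{Z}/d\mathbb{Z}$ and fixing all other colored integers. Then $w\leq_T\gamma$ if and only if $a=n$ and $s=1$.
   Context: Let $\zeta=e^{2\pi i/d}$. $G(d,d,n)$ is the group of $n\times n$ monomial matrices with $d$-th roots of unity as nonzero entries whose product is $1$. Write $k^{(s)}$ ($k\in[n]$, $s\in\mathbb{Z}/d\mathbb{Z}$) for $\zeta^se_k$; elements are identified with the permutations they induce on these colored integers. With $T$ the set of reflections, $\ell_T$ is reflection length and $u\leq_T v$ iff $\ell_T(v)=\ell_T(u)+\ell_T(u^{ -1}v)$. $\gamma$ is the Coxeter element given by $\gamma(k^{(t)})=(k+1)^{(t)}$ for $1\leq k\leq n-2$, $\gamma((n-1)^{(t)})=1^{(t+1)}$, $\gamma(n^{(t)})=n^{(t-1)}$ (in the paper's notation $\gamma=[1^{(0)}\,2^{(0)}\,\dots\,(n-1)^{(0)}][n^{(0)}]_{d-1}$; as a matrix, $\gamma$ has entry $\zeta$ at position $(1,n-1)$, entries $1$ at $(k+1,k)$ for $1\leq k\leq n-2$, and $\zeta^{d-1}$ at $(n,n)$). -}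

module Defs where

open import Data.Nat using (ℕ; zero; suc; _+_; _∸_; _<_; NonZero; _≡ᵇ_)
open import Data.Nat.DivMod using (_mod_)
open import Data.Fin using (Fin; toℕ)
open import Data.Product using (Σ; _×_; _,_)
open import Data.Bool using (if_then_else_)
open import Data.List using (List; []; _∷_; length)
open import Data.List.Relation.Unary.All using (All)
open import Relation.Binary.PropositionalEquality using (_≡_; _≢_)
open import Relation.Nullary using (¬_)

-- Colored integers k^(t): k ∈ Fin n (0-indexed: Fin index i stands for i+1),
-- t ∈ Z/dZ represented by Fin d.
ColInt : ℕ → ℕ → Set
ColInt d n = Fin n × Fin d

-- Elements of G(d,d,n) are identified with the permutations they induce on
-- colored integers.
Perm : ℕ → ℕ → Set
Perm d n = ColInt d n → ColInt d n

module _ {d n : ℕ} .{{_ : NonZero d}} .{{_ : NonZero n}} where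

  _⊕_ : Fin d → ℕ → Fin d
  t ⊕ s = (toℕ t + s) mod d

  _⊖_ : Fin d → ℕ → Fin d
  t ⊖ s = (toℕ t + (d ∸ toℕ (s mod d))) mod d
  
  idP : Perm d n
  idP x = x

  _∘P_ : Perm d n → Perm d n → Perm d n
  (f ∘P g) x = f (g x)

  refl-ijs : Fin n → Fin n → Fin d → Perm d n
  refl-ijs i j s (k , t) =
    if toℕ k ≡ᵇ toℕ i then (j , t ⊕ toℕ s)
    else if toℕ k ≡ᵇ toℕ j then (i , t ⊖ toℕ s)
    else (k , t)

  -- The set T of reflections of G(d,d,n) (d ≥ 2): exactly the elements [i^(0) j^(s)], i ≠ j.
  IsReflection : Perm d n → Set
  IsReflection f = Σ (Fin n) λ i → Σ (Fin n) λ j → Σ (Fin d) λ s →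
    (i ≢ j) × (∀ x → f x ≡ refl-ijs i j s x)

  prodP : List (Perm d n) → Perm d n
  prodP [] = idP
  prodP (f ∷ fs) = f ∘P prodP fs

  FactorLen : Perm d n → ℕ → Set
  FactorLen f k = Σ (List (Perm d n)) λ ts →
    (length ts ≡ k) × All IsReflection ts × (∀ x → prodP ts x ≡ f x)

  ReflLength : Perm d n → ℕ → Set
  ReflLength f k = FactorLen f k × (∀ m → m < k → ¬ FactorLen f m)

  -- u ≤_T v  iff  ℓ_T(v) = ℓ_T(u) + ℓ_T(u⁻¹ v); here x plays the role of u⁻¹ v (u x = v).
  _≤T_ : Perm d n → Perm d n → Set
  u ≤T v = Σ (Perm d n) λ x → (∀ y → u (x y) ≡ v y) ×
    Σ ℕ λ a → Σ ℕ λ b → ReflLength u a × ReflLength x b × ReflLength v (a + b)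

  -- Coxeter element γ = [1^(0) … (n-1)^(0)][n^(0)]_{d-1}
  γ : Perm d n
  γ (k , t) =
    if suc (toℕ k) ≡ᵇ n then (k , t ⊖ 1)
    else if suc (suc (toℕ k)) ≡ᵇ n then (0 mod n , t ⊕ 1)
    else (suc (toℕ k) mod n , t)

  -- w = [1^(0)]_s [a^(0)]_{d-s} : 1^(t) ↦ 1^(t+s), a^(t) ↦ a^(t-s), others fixed.
  -- (Fin index 0 is the integer 1; a is given 0-indexed.)
  wElt : Fin n → Fin d → Perm d n
  wElt a s (k , t) =
    if toℕ k ≡ᵇ 0 then (k , t ⊕ toℕ s)
    else if toℕ k ≡ᵇ toℕ a then (k , t ⊖ toℕ s)
    else (k , t)

-- A product of k reflections [i^(0) j^(s)] preserves every partial section (at most one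
-- colour per index) whose colours satisfy colour(j) = colour(i) + s for each factor. With
-- k < n such relations some nonempty set of indices can be coloured consistently, by
-- contracting or deleting one index at a time, so a product of fewer than n reflections
-- preserves a nonempty partial section. An element shifts colours along each cycle of its
-- index permutation by a total twist, and a nonzero twist keeps invariant partial sections
-- off that cycle. γ has cycles (1 … n-1) and (n) with twists 1 and -1, so ℓ_T(γ) = n.
-- w⁻¹γ has the same cycles, with twists 1 and -1 if a < n and 1 - s and s - 1 if a = n; so
-- unless a = n and s = 1 it has length at least n, contradicting
-- ℓ_T(w) + ℓ_T(w⁻¹γ) = ℓ_T(γ) with ℓ_T(w) ≥ 1. For a = n and s = 1 the factorizations
-- w = [1^(0) n^(0)] [1^(0) n^(1)] and w⁻¹γ = [1^(0) (n-1)^(0)] ⋯ [1^(0) 2^(0)] have lengths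
-- 2 + (n - 2) = n.
module Submission where

open import Defs
open import Data.Nat using (ℕ; _≤_; _∸_; NonZero)
open import Data.Fin using (Fin; toℕ)
open import Data.Product using (_×_)
open import Function.Bundles using (_⇔_; mk⇔)
open import Relation.Binary.PropositionalEquality using (_≡_)

open import Data.Nat using (zero; suc; _+_; _<_; _%_; _≡ᵇ_; z≤n; s≤s; z<s; s≤s⁻¹; _≟_; _≤?_; _<?_; >-nonZero⁻¹)
open import Data.Nat.Properties
open import Data.Nat.DivMod using (_mod_; m%n%n≡m%n; m%n<n; n%n≡0; [m+n]%n≡m%n; m<n⇒m%n≡m; %-distribˡ-+)
open import Data.Nat.Tactic.RingSolver using (solve-∀)
open import Algebra.Properties.CommutativeSemigroup +-commutativeSemigroup using (xy∙z≈xz∙y)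
open import Data.Fin using (zero; suc)
open import Data.Fin.Properties using (toℕ-injective; toℕ-fromℕ<; toℕ<n)
import Data.Fin.Properties as Fin
open import Data.Bool using (true; false; if_then_else_)
open import Data.Maybe using (Maybe; just; nothing; map)
open import Data.Maybe.Properties using (just-injective)
open import Data.Product using (∃-syntax; _,_; proj₁; proj₂)
open import Data.Sum using (_⊎_; inj₁; inj₂)
open import Data.List using (List; []; _∷_; _++_; length)
open import Data.List.Properties using (length-map; length-++)
open import Data.List.Relation.Unary.All using (All; []; _∷_)
import Data.List.Relation.Unary.All.Properties as All
open import Data.Vec.Functional using () renaming (_∷_ to _∷ᶠ_)
open import Function using (const)
open import Relation.Nullary using (¬_; Dec; yes; no; contradiction)
open import Relation.Nullary.Decidable using (dec-false; _×-dec_)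
open import Relation.Binary.PropositionalEquality
  using (_≢_; refl; sym; trans; cong; cong₂; subst; module ≡-Reasoning)

≡ᵇ-refl : ∀ m → (m ≡ᵇ m) ≡ true
≡ᵇ-refl zero = refl
≡ᵇ-refl (suc m) = ≡ᵇ-refl m

≢⇒≡ᵇ-false : ∀ {m n} → m ≢ n → (m ≡ᵇ n) ≡ false
≢⇒≡ᵇ-false = dec-false (_ ≟ _)

module ModularArithmetic (d : ℕ) .{{_ : NonZero d}} where

  open ≡-Reasoning

  infix 4 _≈_ _≈?_

  _≈_ : ℕ → ℕ → Set
  x ≈ y = x % d ≡ y % d

  _≈?_ : ∀ x y → Dec (x ≈ y)
  x ≈? y = x % d ≟ y % d

  neg : ℕ → ℕ
  neg x = d ∸ x % d

  %-≈ : ∀ x → x % d ≈ x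
  %-≈ x = m%n%n≡m%n x d

  0≈d : 0 ≈ d
  0≈d = trans (m<n⇒m%n≡m (>-nonZero⁻¹ d)) (sym (n%n≡0 d))

  +-cong : ∀ {x x′ y y′} → x ≈ x′ → y ≈ y′ → x + y ≈ x′ + y′
  +-cong {x} {x′} {y} {y′} x≈x′ y≈y′ = begin
    (x + y) % d            ≡⟨ %-distribˡ-+ x y d ⟩
    (x % d + y % d) % d    ≡⟨ cong₂ (λ a b → (a + b) % d) x≈x′ y≈y′ ⟩
    (x′ % d + y′ % d) % d  ≡⟨ %-distribˡ-+ x′ y′ d ⟨
    (x′ + y′) % d          ∎

  +-congˡ : ∀ {x x′} y → x ≈ x′ → x + y ≈ x′ + y
  +-congˡ y x≈x′ = +-cong x≈x′ refl

  +-congʳ : ∀ x {y y′} → y ≈ y′ → x + y ≈ x + y′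
  +-congʳ x y≈y′ = +-cong refl y≈y′

  +-neg≈0 : ∀ x → x + neg x ≈ 0
  +-neg≈0 x = begin
    (x + neg x) % d      ≡⟨ +-congˡ (neg x) (%-≈ x) ⟨
    (x % d + neg x) % d  ≡⟨ cong (_% d) (m+[n∸m]≡n (<⇒≤ (m%n<n x d))) ⟩
    d % d                ≡⟨ 0≈d ⟨
    0 % d                ∎

  +-neg-cancelʳ : ∀ x y → x + y + neg y ≈ x
  +-neg-cancelʳ x y = begin
    (x + y + neg y) % d    ≡⟨ cong (_% d) (+-assoc x y (neg y)) ⟩
    (x + (y + neg y)) % d  ≡⟨ +-congʳ x (+-neg≈0 y) ⟩
    (x + 0) % d            ≡⟨ cong (_% d) (+-identityʳ x) ⟩
    x % d                  ∎

  neg-+-cancelʳ : ∀ x y → x + neg y + y ≈ x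
  neg-+-cancelʳ x y = trans (cong (_% d) (xy∙z≈xz∙y x (neg y) y)) (+-neg-cancelʳ x y)

  +-cancelʳ : ∀ {x y} z → x + z ≈ y + z → x ≈ y
  +-cancelʳ {x} {y} z x+z≈y+z = begin
    x % d              ≡⟨ +-neg-cancelʳ x z ⟨
    (x + z + neg z) % d  ≡⟨ +-congˡ (neg z) x+z≈y+z ⟩
    (y + z + neg z) % d  ≡⟨ +-neg-cancelʳ y z ⟩
    y % d              ∎

  x+g≈x⇒g≈0 : ∀ {x g} → x + g ≈ x → g ≈ 0
  x+g≈x⇒g≈0 {x} {g} x+g≈x = +-cancelʳ x (trans (cong (_% d) (+-comm g x)) x+g≈x)

  positive⇒≉0 : ∀ {x} → 0 < x → x < d → ¬ x ≈ 0
  positive⇒≉0 {x} 0<x x<d x≈0 =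
    <⇒≢ 0<x (sym (trans (sym (m<n⇒m%n≡m x<d)) (trans x≈0 (m<n⇒m%n≡m (>-nonZero⁻¹ d)))))

  neg-< : ∀ {x} → x < d → neg x ≡ d ∸ x
  neg-< x<d = cong (d ∸_) (m<n⇒m%n≡m x<d)

  neg≉0 : ∀ {x} → 0 < x → x < d → ¬ neg x ≈ 0
  neg≉0 {x} 0<x x<d rewrite neg-< x<d = positive⇒≉0 (m<n⇒0<n∸m x<d) (∸-monoʳ-< 0<x (<⇒≤ x<d))

  1+neg≉0 : ∀ {x} → 1 < x → x < d → ¬ 1 + neg x ≈ 0
  1+neg≉0 {x} 1<x x<d rewrite neg-< x<d =
    positive⇒≉0 z<s (≤-trans (s≤s (∸-monoʳ-< 1<x (<⇒≤ x<d))) (≤-reflexive 1+[d∸1]≡d))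
    where
      1+[d∸1]≡d : suc (d ∸ 1) ≡ d
      1+[d∸1]≡d = trans (+-comm 1 (d ∸ 1)) (m∸n+n≡m (>-nonZero⁻¹ d))

  neg1+≉0 : ∀ {x} → 1 < x → x < d → ¬ neg 1 + x ≈ 0
  neg1+≉0 {suc x} 1<x x<d neg1+x≈0 rewrite neg-< (<-trans 1<x x<d) =
    positive⇒≉0 (s≤s⁻¹ 1<x) (<-trans (n<1+n x) x<d) (trans (sym ([m+n]%n≡m%n x d)) (trans (cong (_% d) x+d≡d∸1+1+x) neg1+x≈0))
    where
      x+d≡d∸1+1+x : x + d ≡ d ∸ 1 + suc x
      x+d≡d∸1+1+x = trans (+-comm x d) (trans (cong (_+ x) (sym (m∸n+n≡m (<-trans z<s (<-trans 1<x x<d))))) (+-assoc (d ∸ 1) 1 x))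

module GainGraph (d : ℕ) .{{_ : NonZero d}} where

  open ModularArithmetic d

  Edge : ℕ → Set
  Edge m = Fin m × Fin m × ℕ

  Potential : ℕ → Set
  Potential m = Fin m → Maybe ℕ

  data Related (g : ℕ) : Maybe ℕ → Maybe ℕ → Set where
    nothing : Related g nothing nothing
    just    : ∀ {x y} → x + g ≈ y → Related g (just x) (just y)

  Satisfies : ∀ {m} → Potential m → Edge m → Set
  Satisfies φ (i , j , g) = Related g (φ i) (φ j)

  NonTrivial : ∀ {m} → Potential m → Set
  NonTrivial φ = ∃[ v ] ∃[ x ] φ v ≡ just x

  Related-flip : ∀ {g a b} → Related (neg g) a b → Related g b a
  Related-flip nothing = nothing
  Related-flip {g} (just {x} x-g≈y) = just (trans (+-congˡ g (sym x-g≈y)) (neg-+-cancelʳ x g))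

  Related-loop : ∀ {g a} → ¬ g ≈ 0 → Related g a a → a ≡ nothing
  Related-loop g≉0 nothing = refl
  Related-loop g≉0 (just x+g≈x) = contradiction (x+g≈x⇒g≈0 x+g≈x) g≉0

  Related-shift : ∀ {g a b} c c′ → Related (c + g + neg c′) a b → Related g (map (_+ c) a) (map (_+ c′) b)
  Related-shift c c′ nothing = nothing
  Related-shift {g} c c′ (just {x} {y} x+h≈y) = just (begin
    (x + c + g) % d                   ≡⟨ neg-+-cancelʳ (x + c + g) c′ ⟨
    (x + c + g + neg c′ + c′) % d     ≡⟨ cong (λ z → (z + c′) % d) (reassoc x c g (neg c′)) ⟩
    (x + (c + g + neg c′) + c′) % d   ≡⟨ +-congˡ c′ x+h≈y ⟩
    (y + c′) % d                      ∎)
    where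
      open ≡-Reasoning
      reassoc : ∀ a b c e → a + b + c + e ≡ a + (b + c + e)
      reassoc = solve-∀

  Solvable : ∀ {m} → List (Edge m) → Set
  Solvable es = ∃[ φ ] NonTrivial φ × All (Satisfies φ) es

  record Splitting {m} (es : List (Edge m)) (e : Edge m) : Set where
    field
      rest    : List (Edge m)
      shorter : length rest < length es
      combine : ∀ φ → Satisfies φ e → All (Satisfies φ) rest → All (Satisfies φ) es

  splitHead : ∀ {m} {e e′ : Edge m} {es} → (∀ {φ} → Satisfies φ e′ → Satisfies φ e) → Splitting (e ∷ es) e′
  splitHead {es = es} e′⇒e = record { rest = es ; shorter = ≤-refl ; combine = λ _ s all → e′⇒e s ∷ all }

  splitLater : ∀ {m} {e e′ : Edge m} {es} → Splitting es e′ → Splitting (e ∷ es) e′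
  splitLater {e = e} sp = record
    { rest = e ∷ rest
    ; shorter = s≤s shorter
    ; combine = λ { φ s (se ∷ all) → se ∷ combine φ s all }
    }
    where open Splitting sp

  rest-< : ∀ {m e} {es : List (Edge (suc m))} (sp : Splitting es e) → length es < suc m → length (Splitting.rest sp) < m
  rest-< sp es<m = <-≤-trans (Splitting.shorter sp) (s≤s⁻¹ es<m)

  data AtZero {m} (es : List (Edge (suc m))) : Set where
    isolated : All (Satisfies (just 0 ∷ᶠ const nothing)) es → AtZero es
    loop     : ∀ g → ¬ g ≈ 0 → Splitting es (zero , zero , g) → AtZero es
    edge     : ∀ u g → Splitting es (zero , suc u , g) → AtZero es

  keep : ∀ {m} {e} {es : List (Edge (suc m))} → Satisfies (just 0 ∷ᶠ const nothing) e → AtZero es → AtZero (e ∷ es)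
  keep s (isolated all)  = isolated (s ∷ all)
  keep s (loop g g≉0 sp) = loop g g≉0 (splitLater sp)
  keep s (edge u g sp)   = edge u g (splitLater sp)

  atZero : ∀ {m} (es : List (Edge (suc m))) → AtZero es
  atZero [] = isolated []
  atZero ((suc x , suc y , g) ∷ es) = keep nothing (atZero es)
  atZero ((zero , zero , g) ∷ es) with g ≈? 0
  ... | yes g≈0 = keep (just g≈0) (atZero es)
  ... | no g≉0  = loop g g≉0 (splitHead λ s → s)
  atZero ((zero , suc u , g) ∷ es) = edge u g (splitHead λ s → s)
  atZero ((suc u , zero , g) ∷ es) = edge u (neg g) (splitHead Related-flip)

  -- Vertex zero carries a loop of nonzero gain g, so it cannot be covered; each of its
  -- neighbours is then excluded by a loop of the same gain.
  deleteZero : ∀ {m} → ℕ → List (Edge (suc m)) → List (Edge m)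
  deleteZero g [] = []
  deleteZero g ((zero , zero , _) ∷ es)    = deleteZero g es
  deleteZero g ((zero , suc y , _) ∷ es)   = (y , y , g) ∷ deleteZero g es
  deleteZero g ((suc x , zero , _) ∷ es)   = (x , x , g) ∷ deleteZero g es
  deleteZero g ((suc x , suc y , h) ∷ es)  = (x , y , h) ∷ deleteZero g es

  length-deleteZero : ∀ {m} g (es : List (Edge (suc m))) → length (deleteZero g es) ≤ length es
  length-deleteZero g [] = z≤n
  length-deleteZero g ((zero , zero , _) ∷ es)   = m≤n⇒m≤1+n (length-deleteZero g es)
  length-deleteZero g ((zero , suc y , _) ∷ es)  = s≤s (length-deleteZero g es)
  length-deleteZero g ((suc x , zero , _) ∷ es)  = s≤s (length-deleteZero g es)
  length-deleteZero g ((suc x , suc y , _) ∷ es) = s≤s (length-deleteZero g es)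

  deleteZero-sound : ∀ {m g} {φ : Potential m} → ¬ g ≈ 0 → ∀ es →
    All (Satisfies φ) (deleteZero g es) → All (Satisfies (nothing ∷ᶠ φ)) es
  deleteZero-sound g≉0 [] _ = []
  deleteZero-sound g≉0 ((zero , zero , _) ∷ es) all = nothing ∷ deleteZero-sound g≉0 es all
  deleteZero-sound g≉0 ((zero , suc y , _) ∷ es) (s ∷ all) =
    subst (Related _ nothing) (sym (Related-loop g≉0 s)) nothing ∷ deleteZero-sound g≉0 es all
  deleteZero-sound g≉0 ((suc x , zero , _) ∷ es) (s ∷ all) =
    subst (λ a → Related _ a nothing) (sym (Related-loop g≉0 s)) nothing ∷ deleteZero-sound g≉0 es all
  deleteZero-sound g≉0 ((suc x , suc y , _) ∷ es) (s ∷ all) = s ∷ deleteZero-sound g≉0 es all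

  pullback : ∀ {m m′} → (Fin m′ → Fin m) → (Fin m′ → ℕ) → Edge m′ → Edge m
  pullback ρ o (i , j , g) = ρ i , ρ j , o i + g + neg (o j)

  shift : ∀ {m m′} → (Fin m′ → Fin m) → (Fin m′ → ℕ) → Potential m → Potential m′
  shift ρ o φ v = map (_+ o v) (φ (ρ v))

  -- Contracting the edge from zero to suc u identifies zero with u, offset by -g.
  module Contraction {m} (u : Fin m) (g : ℕ) where

    ρ : Fin (suc m) → Fin m
    ρ = u ∷ᶠ λ v → v

    o : Fin (suc m) → ℕ
    o = neg g ∷ᶠ const 0

    contracted-edge : ∀ φ → Satisfies (shift ρ o φ) (zero , suc u , g)
    contracted-edge φ with φ u
    ... | nothing = nothing
    ... | just x  = just (trans (neg-+-cancelʳ x g) (cong (_% d) (sym (+-identityʳ x))))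

    contract-sound : ∀ {φ : Potential m} es → All (Satisfies φ) (Data.List.map (pullback ρ o) es) → All (Satisfies (shift ρ o φ)) es
    contract-sound [] [] = []
    contract-sound ((i , j , _) ∷ es) (s ∷ all) = Related-shift (o i) (o j) s ∷ contract-sound es all

  sparse⇒solvable : ∀ {m} (es : List (Edge m)) → length es < m → Solvable es
  sparse⇒solvable {suc m} es es<m with atZero es
  ... | isolated all = _ , (zero , 0 , refl) , all
  ... | loop g g≉0 sp =
    delete (sparse⇒solvable (deleteZero g rest) (≤-<-trans (length-deleteZero g rest) (rest-< sp es<m)))
    where
      open Splitting sp
      delete : Solvable (deleteZero g rest) → Solvable es
      delete (φ , (v , x , φv≡x) , all) =
        nothing ∷ᶠ φ , (suc v , x , φv≡x) , combine _ nothing (deleteZero-sound g≉0 rest all)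
  ... | edge u g sp =
    contract (sparse⇒solvable (Data.List.map (pullback ρ o) rest) (subst (_< m) (sym (length-map _ rest)) (rest-< sp es<m)))
    where
      open Splitting sp
      open Contraction u g
      contract : Solvable (Data.List.map (pullback ρ o) rest) → Solvable es
      contract (φ , (v , x , φv≡x) , all) =
        shift ρ o φ , (suc v , x + 0 , cong (map (_+ 0)) φv≡x) , combine _ (contracted-edge φ) (contract-sound rest all)

module ColouredPermutations (d n : ℕ) .{{_ : NonZero d}} .{{_ : NonZero n}} where

  open ModularArithmetic d
  open GainGraph d

  toℕ-mod : ∀ x → toℕ (x mod d) ≡ x % d
  toℕ-mod x = toℕ-fromℕ< _

  toℕ-mod-≈ : ∀ x → toℕ (x mod d) ≈ x
  toℕ-mod-≈ x = trans (cong (_% d) (toℕ-mod x)) (%-≈ x)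

  mod-cong : ∀ {x y} → x ≈ y → x mod d ≡ y mod d
  mod-cong {x} {y} x≈y = toℕ-injective (trans (toℕ-mod x) (trans x≈y (sym (toℕ-mod y))))

  ⊖-mod : ∀ (t : Fin d) s → t ⊖ s ≡ (toℕ t + neg s) mod d
  ⊖-mod t s = cong (λ z → (toℕ t + (d ∸ z)) mod d) (toℕ-mod s)

  toℕ-⊕ : ∀ (t : Fin d) s → toℕ (t ⊕ s) ≈ toℕ t + s
  toℕ-⊕ t s = toℕ-mod-≈ (toℕ t + s)

  toℕ-⊖ : ∀ (t : Fin d) s → toℕ (t ⊖ s) ≈ toℕ t + neg s
  toℕ-⊖ t s = trans (cong (λ u → toℕ u % d) (⊖-mod t s)) (toℕ-mod-≈ (toℕ t + neg s))

  shifted-≢ : ∀ {u t : Fin d} {h} → toℕ u ≈ toℕ t + h → ¬ h ≈ 0 → u ≢ t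
  shifted-≢ {h = h} u≈t+h h≉0 refl = h≉0 (x+g≈x⇒g≈0 (sym u≈t+h))

  ≈⇒≡ : ∀ {t u : Fin d} → toℕ t ≈ toℕ u → t ≡ u
  ≈⇒≡ {t} {u} t≈u = toℕ-injective (trans (sym (m<n⇒m%n≡m (toℕ<n t))) (trans t≈u (m<n⇒m%n≡m (toℕ<n u))))

  ⊕-⊖ : ∀ (t : Fin d) s → (t ⊕ s) ⊖ s ≡ t
  ⊕-⊖ t s = ≈⇒≡ (trans (toℕ-⊖ (t ⊕ s) s) (trans (+-congˡ (neg s) (toℕ-⊕ t s)) (+-neg-cancelʳ (toℕ t) s)))

  ⊖-⊕ : ∀ (t : Fin d) s → (t ⊖ s) ⊕ s ≡ t
  ⊖-⊕ t s = ≈⇒≡ (trans (toℕ-⊕ (t ⊖ s) s) (trans (+-congˡ s (toℕ-⊖ t s)) (neg-+-cancelʳ (toℕ t) s)))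

  ⊕-identityʳ : ∀ (t : Fin d) → t ⊕ 0 ≡ t
  ⊕-identityʳ t = ≈⇒≡ (trans (toℕ-⊕ t 0) (cong (_% d) (+-identityʳ (toℕ t))))

  ⊖-identityʳ : ∀ (t : Fin d) → t ⊖ 0 ≡ t
  ⊖-identityʳ t = ≈⇒≡ (trans (toℕ-⊖ t 0) (trans (cong (λ z → (z + neg 0) % d) (sym (+-identityʳ (toℕ t)))) (+-neg-cancelʳ (toℕ t) 0)))

  PartialSection : Set
  PartialSection = Fin n → Maybe (Fin d)

  infix 4 _∈_

  _∈_ : ColInt d n → PartialSection → Set
  x ∈ S = S (proj₁ x) ≡ just (proj₂ x)

  NonEmpty : PartialSection → Set
  NonEmpty S = ∃[ x ] x ∈ S

  Invariant : Perm d n → PartialSection → Set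
  Invariant f S = ∀ x → x ∈ S → f x ∈ S

  sectionOf : Potential n → PartialSection
  sectionOf φ k = map (_mod d) (φ k)

  Related-⊕ : ∀ {s a b t} → Related s a b → map (_mod d) a ≡ just t → map (_mod d) b ≡ just (t ⊕ s)
  Related-⊕ {s} (just {x} {y} x+s≈y) refl = cong just (mod-cong (trans (sym x+s≈y) (+-congˡ s (sym (toℕ-mod-≈ x)))))

  Related-⊖ : ∀ {s a b t} → Related s a b → map (_mod d) b ≡ just t → map (_mod d) a ≡ just (t ⊖ s)
  Related-⊖ {s} (just {x} {y} x+s≈y) refl = cong just (trans (mod-cong x≈y-s) (sym (⊖-mod (y mod d) s)))
    where
      x≈y-s : x ≈ toℕ (y mod d) + neg s
      x≈y-s = trans (sym (+-neg-cancelʳ x s)) (+-congˡ (neg s) (trans x+s≈y (sym (toℕ-mod-≈ y))))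

  ≢⇒toℕ-≡ᵇ-false : ∀ {k i : Fin n} → k ≢ i → (toℕ k ≡ᵇ toℕ i) ≡ false
  ≢⇒toℕ-≡ᵇ-false k≢i = ≢⇒≡ᵇ-false (λ e → k≢i (toℕ-injective e))

  refl-ijs-i : ∀ (i j : Fin n) (s t : Fin d) → refl-ijs i j s (i , t) ≡ (j , t ⊕ toℕ s)
  refl-ijs-i i j s t rewrite ≡ᵇ-refl (toℕ i) = refl

  refl-ijs-j : ∀ {i j : Fin n} (s t : Fin d) → i ≢ j → refl-ijs i j s (j , t) ≡ (i , t ⊖ toℕ s)
  refl-ijs-j {i} {j} s t i≢j rewrite ≢⇒toℕ-≡ᵇ-false (λ e → i≢j (sym e)) | ≡ᵇ-refl (toℕ j) = refl

  refl-ijs-other : ∀ {i j k : Fin n} (s t : Fin d) → k ≢ i → k ≢ j → refl-ijs i j s (k , t) ≡ (k , t)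
  refl-ijs-other s t k≢i k≢j rewrite ≢⇒toℕ-≡ᵇ-false k≢i | ≢⇒toℕ-≡ᵇ-false k≢j = refl

  prodP-++ : ∀ (ts us : List (Perm d n)) x → prodP (ts ++ us) x ≡ prodP ts (prodP us x)
  prodP-++ [] us x = refl
  prodP-++ (t ∷ ts) us x = cong t (prodP-++ ts us x)

  FactorLen-resp : ∀ {f g : Perm d n} {k} → (∀ x → f x ≡ g x) → FactorLen f k → FactorLen g k
  FactorLen-resp f≗g (ts , len , rs , prod≗f) = ts , len , rs , λ x → trans (prod≗f x) (f≗g x)

  FactorLen-∘ : ∀ {f g : Perm d n} {k l} → FactorLen f k → FactorLen g l → FactorLen (f ∘P g) (k + l)
  FactorLen-∘ {g = g} (ts , refl , rs , ts≗f) (us , refl , qs , us≗g) =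
    ts ++ us , length-++ ts , All.++⁺ rs qs ,
    λ x → trans (prodP-++ ts us x) (trans (cong (prodP ts) (us≗g x)) (ts≗f (g x)))

  FactorLen-refl-ijs : ∀ {i j : Fin n} (s : Fin d) → i ≢ j → FactorLen (refl-ijs i j s) 1
  FactorLen-refl-ijs {i} {j} s i≢j = refl-ijs i j s ∷ [] , refl , (i , j , s , i≢j , λ _ → refl) ∷ [] , λ _ → refl

  FactorLen-0 : ∀ {f : Perm d n} → FactorLen f 0 → ∀ x → f x ≡ x
  FactorLen-0 ([] , refl , [] , id≗f) x = sym (id≗f x)

  -- A single reflection [i j] moves the index i.
  FactorLen-1 : ∀ {f : Perm d n} → FactorLen f 1 → ¬ (∀ x → proj₁ (f x) ≡ proj₁ x)
  FactorLen-1 (r ∷ [] , refl , (i , j , s , i≢j , r≗) ∷ [] , r≗f) keeps-index =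
    i≢j (trans (sym (keeps-index (i , s))) (trans (sym (cong proj₁ (r≗f (i , s)))) (cong proj₁ (trans (r≗ (i , s)) (refl-ijs-i i j s s)))))

  minimal-≤ : ∀ {f : Perm d n} {k l} → (∀ m → m < k → ¬ FactorLen f m) → FactorLen f l → k ≤ l
  minimal-≤ {l = l} minimal fl = ≮⇒≥ (λ l<k → minimal l l<k fl)

  Invariant-reflection : ∀ {i j : Fin n} {s : Fin d} {φ} → i ≢ j → Satisfies φ (i , j , toℕ s) → Invariant (refl-ijs i j s) (sectionOf φ)
  Invariant-reflection {i} {j} {s} {φ} i≢j sat (k , t) k∈ with k Fin.≟ i | k Fin.≟ j
  ... | yes refl | _ = subst (_∈ sectionOf φ) (sym (refl-ijs-i i j s t)) (Related-⊕ sat k∈)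
  ... | no _ | yes refl = subst (_∈ sectionOf φ) (sym (refl-ijs-j s t i≢j)) (Related-⊖ sat k∈)
  ... | no k≢i | no k≢j = subst (_∈ sectionOf φ) (sym (refl-ijs-other s t k≢i k≢j)) k∈

  edgesOf : ∀ {ts : List (Perm d n)} → All IsReflection ts → List (Edge n)
  edgesOf [] = []
  edgesOf ((i , j , s , _) ∷ rs) = (i , j , toℕ s) ∷ edgesOf rs

  length-edgesOf : ∀ {ts : List (Perm d n)} (rs : All IsReflection ts) → length (edgesOf rs) ≡ length ts
  length-edgesOf [] = refl
  length-edgesOf (_ ∷ rs) = cong suc (length-edgesOf rs)

  Invariant-prodP : ∀ {ts : List (Perm d n)} (rs : All IsReflection ts) {φ} → All (Satisfies φ) (edgesOf rs) → Invariant (prodP ts) (sectionOf φ)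
  Invariant-prodP [] [] x x∈ = x∈
  Invariant-prodP ((i , j , s , i≢j , t≗r) ∷ rs) {φ} (sat ∷ sats) x x∈ =
    subst (_∈ sectionOf φ) (sym (t≗r _)) (Invariant-reflection i≢j sat _ (Invariant-prodP rs sats x x∈))

  -- The reflections of a short factorization form a gain graph with fewer edges than
  -- vertices; a potential on part of it is a partial section they all preserve.
  short⇒invariantSection : ∀ {f : Perm d n} {k} → FactorLen f k → k < n → ∃[ S ] NonEmpty S × Invariant f S
  short⇒invariantSection (ts , refl , rs , prod≗f) k<n
    with sparse⇒solvable (edgesOf rs) (subst (_< n) (sym (length-edgesOf rs)) k<n)
  ... | φ , (v , x , φv≡x) , sats =
    sectionOf φ , ((v , x mod d) , cong (map (_mod d)) φv≡x) ,
    λ y y∈ → subst (_∈ sectionOf φ) (prod≗f y) (Invariant-prodP rs sats y y∈)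

  ∈-index : ∀ {S} {k k′ : Fin n} {t} → k ≡ k′ → (k , t) ∈ S → (k′ , t) ∈ S
  ∈-index refl k∈ = k∈

  fixedPoint-avoids : ∀ (f : Perm d n) L → (∀ t → proj₁ (f (L , t)) ≡ L) → (∀ t → proj₂ (f (L , t)) ≢ t) →
    ∀ {S} → Invariant f S → ∀ t → ¬ (L , t) ∈ S
  fixedPoint-avoids f L fixes moves {S} inv t L∈ =
    moves t (just-injective (trans (sym (∈-index {S} (fixes t) (inv _ L∈))) L∈))

  module Cycle (f : Perm d n) (c : ℕ → Fin n) (top : ℕ)
               (along : ∀ j t → j < top → proj₁ (f (c j , t)) ≡ c (suc j))
               (closes : ∀ t → proj₁ (f (c top , t)) ≡ c 0) where

    transport : ℕ → Fin d → Fin d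
    transport zero t = t
    transport (suc j) t = proj₂ (f (c j , transport j t))

    holonomy : Fin d → Fin d
    holonomy t = proj₂ (f (c top , transport top t))

    holonomy-≡ : ∀ {t u} → transport top t ≡ u → holonomy t ≡ proj₂ (f (c top , u))
    holonomy-≡ = cong (λ u → proj₂ (f (c top , u)))

    module _ {S} (inv : Invariant f S) where

      ∈-along : ∀ {j t} → j < top → (c j , t) ∈ S → (c (suc j) , proj₂ (f (c j , t))) ∈ S
      ∈-along {j} {t} j<top c∈ = ∈-index {S} (along j t j<top) (inv _ c∈)

      ∈-closes : ∀ {t} → (c top , t) ∈ S → (c 0 , proj₂ (f (c top , t))) ∈ S
      ∈-closes {t} c∈ = ∈-index {S} (closes t) (inv _ c∈)

      reach-top : ∀ k {j t} → j + k ≡ top → (c j , t) ∈ S → ∃[ t′ ] (c top , t′) ∈ S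
      reach-top zero {j} j+0≡top c∈ = _ , ∈-index {S} (cong c (trans (sym (+-identityʳ j)) j+0≡top)) c∈
      reach-top (suc k) {j} j+k+1≡top c∈ =
        reach-top k (trans (sym (+-suc j k)) j+k+1≡top) (∈-along (subst (j <_) j+k+1≡top (m<m+n j z<s)) c∈)

      transport-∈ : ∀ {t} → (c 0 , t) ∈ S → ∀ j → j ≤ top → (c j , transport j t) ∈ S
      transport-∈ c∈ zero _ = c∈
      transport-∈ c∈ (suc j) j<top = ∈-along j<top (transport-∈ c∈ j (<⇒≤ j<top))

      holonomy-trivial : ∀ {t} → (c 0 , t) ∈ S → holonomy t ≡ t
      holonomy-trivial c∈ = just-injective (trans (sym (∈-closes (transport-∈ c∈ top ≤-refl))) c∈)

    cycle-avoids : (∀ t → holonomy t ≢ t) → ∀ {S} → Invariant f S → ∀ j t → j ≤ top → ¬ (c j , t) ∈ S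
    cycle-avoids nontrivial inv j t j≤top c∈ with reach-top inv (top ∸ j) (m+[n∸m]≡n j≤top) c∈
    ... | t′ , top∈ = nontrivial _ (holonomy-trivial inv (∈-closes inv top∈))

module CoxeterElement (d top : ℕ) .{{_ : NonZero d}} (2≤d : 2 ≤ d) where

  N : ℕ
  N = suc (suc top)

  open ModularArithmetic d
  open ColouredPermutations d N

  -- ι j is the integer j + 1: γ cycles ι 0 → ι 1 → … → ι top → ι 0 and fixes last = n.
  ι : ℕ → Fin N
  ι j = j mod N

  last : Fin N
  last = ι (suc top)

  toℕ-ι : ∀ {j} → j < N → toℕ (ι j) ≡ j
  toℕ-ι j<N = trans (toℕ-fromℕ< _) (m<n⇒m%n≡m j<N)

  ι-toℕ : ∀ k → ι (toℕ k) ≡ k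
  ι-toℕ k = toℕ-injective (toℕ-ι (toℕ<n k))

  index-cases : ∀ k → (∃[ j ] j ≤ top × ι j ≡ k) ⊎ last ≡ k
  index-cases k with toℕ k ≤? top
  ... | yes k≤top = inj₁ (toℕ k , k≤top , ι-toℕ k)
  ... | no k≰top = inj₂ (trans (cong ι (sym (≤-antisym (s≤s⁻¹ (toℕ<n k)) (≰⇒> k≰top)))) (ι-toℕ k))

  γ-step : ∀ {j} t → j < top → γ (ι j , t) ≡ (ι (suc j) , t)
  γ-step {j} t j<top
    rewrite toℕ-ι {j} (m<n⇒m<1+n (m<n⇒m<1+n j<top))
          | ≢⇒≡ᵇ-false {suc j} {N} (λ e → <⇒≢ (m<n⇒m<1+n j<top) (suc-injective e))
          | ≢⇒≡ᵇ-false {suc (suc j)} {N} (λ e → <⇒≢ j<top (suc-injective (suc-injective e))) = refl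

  γ-wrap : ∀ t → γ (ι top , t) ≡ (ι 0 , t ⊕ 1)
  γ-wrap t rewrite toℕ-ι {top} (m<n⇒m<1+n ≤-refl) | ≢⇒≡ᵇ-false {suc top} {N} (λ e → 1+n≢n (sym e)) | ≡ᵇ-refl top = refl

  γ-last : ∀ t → γ (last , t) ≡ (last , t ⊖ 1)
  γ-last t rewrite toℕ-ι {suc top} ≤-refl | ≡ᵇ-refl top = refl

  NoInvariantSection : Perm d N → Set
  NoInvariantSection f = ∀ {S} → Invariant f S → ¬ NonEmpty S

  NoInvariantSection⇒long : ∀ {f k} → NoInvariantSection f → FactorLen f k → N ≤ k
  NoInvariantSection⇒long {k = k} none fl with k <? N
  ... | no k≮N = ≮⇒≥ k≮N
  ... | yes k<N with short⇒invariantSection fl k<N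
  ...   | S , nonEmpty , inv = contradiction nonEmpty (none inv)

  module WithIndicesOfγ (f : Perm d N) (same : ∀ x → proj₁ (f x) ≡ proj₁ (γ x)) where

    open Cycle f ι top (λ j t j<top → trans (same _) (cong proj₁ (γ-step t j<top)))
                       (λ t → trans (same _) (cong proj₁ (γ-wrap t))) public

    noInvariantSection : (∀ t → holonomy t ≢ t) → (∀ t → proj₂ (f (last , t)) ≢ t) → NoInvariantSection f
    noInvariantSection twisted moves inv ((k , t) , k∈) with index-cases k
    ... | inj₁ (j , j≤top , refl) = cycle-avoids twisted inv j t j≤top k∈
    ... | inj₂ refl = fixedPoint-avoids f last (λ t → trans (same _) (cong proj₁ (γ-last t))) moves inv t k∈

  1≉0 : ¬ 1 ≈ 0
  1≉0 = positive⇒≉0 z<s 2≤d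

  ⊖1-≢ : ∀ (t : Fin d) → t ⊖ 1 ≢ t
  ⊖1-≢ t = shifted-≢ (toℕ-⊖ t 1) (neg≉0 z<s 2≤d)

  toℕ-ι-suc : ∀ {j} → j ≤ top → toℕ (ι (suc j)) ≡ suc j
  toℕ-ι-suc j≤top = toℕ-ι (s≤s (s≤s j≤top))

  ι-suc≢0 : ∀ {j} → j ≤ top → ι (suc j) ≢ zero
  ι-suc≢0 j≤top e = 1+n≢0 (trans (sym (toℕ-ι-suc j≤top)) (cong toℕ e))

  γ-noInvariantSection : NoInvariantSection γ
  γ-noInvariantSection = noInvariantSection twisted (λ t → subst (_≢ t) (sym (cong proj₂ (γ-last t))) (⊖1-≢ t))
    where
      open WithIndicesOfγ γ (λ _ → refl)
      transport-γ : ∀ j t → j ≤ top → transport j t ≡ t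
      transport-γ zero t _ = refl
      transport-γ (suc j) t j<top rewrite transport-γ j t (<⇒≤ j<top) = cong proj₂ (γ-step t j<top)
      twisted : ∀ t → holonomy t ≢ t
      twisted t = subst (_≢ t) (sym (trans (holonomy-≡ (transport-γ top t ≤-refl)) (cong proj₂ (γ-wrap t))))
                        (shifted-≢ (toℕ-⊕ t 1) 1≉0)

  last≢0 : last ≢ zero
  last≢0 = ι-suc≢0 ≤-refl

  -- d is only known to be nonzero, so the colours 0 and 1 are written as x mod d.
  0ᶜ : Fin d
  0ᶜ = 0 mod d

  toℕ-0ᶜ : toℕ 0ᶜ ≡ 0
  toℕ-0ᶜ = trans (toℕ-mod 0) (m<n⇒m%n≡m (>-nonZero⁻¹ d))

  1ᶜ : Fin d
  1ᶜ = 1 mod d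

  toℕ-1ᶜ : toℕ 1ᶜ ≡ 1
  toℕ-1ᶜ = trans (toℕ-mod 1) (m<n⇒m%n≡m 2≤d)

  ⊕-0ᶜ : ∀ t → t ⊕ toℕ 0ᶜ ≡ t
  ⊕-0ᶜ t = trans (cong (t ⊕_) toℕ-0ᶜ) (⊕-identityʳ t)

  ⊖-0ᶜ : ∀ t → t ⊖ toℕ 0ᶜ ≡ t
  ⊖-0ᶜ t = trans (cong (t ⊖_) toℕ-0ᶜ) (⊖-identityʳ t)

  star : ℕ → List (Perm d N)
  star zero = []
  star (suc m) = refl-ijs zero (ι (suc m)) 0ᶜ ∷ star m

  length-star : ∀ m → length (star m) ≡ m
  length-star zero = refl
  length-star (suc m) = cong suc (length-star m)

  star-reflections : ∀ m → m ≤ top → All IsReflection (star m)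
  star-reflections zero _ = []
  star-reflections (suc m) 1+m≤top =
    (zero , ι (suc m) , 0ᶜ , (λ e → ι-suc≢0 (<⇒≤ 1+m≤top) (sym e)) , λ _ → refl) ∷ star-reflections m (<⇒≤ 1+m≤top)

  star-FactorLen : FactorLen (prodP (star top)) top
  star-FactorLen = star top , length-star top , star-reflections top ≤-refl , λ _ → refl

  star-above : ∀ m k t → m < toℕ k → prodP (star m) (k , t) ≡ (k , t)
  star-above zero k t _ = refl
  star-above (suc m) k t 1+m<k rewrite star-above m k t (<-trans (n<1+n m) 1+m<k) =
    refl-ijs-other 0ᶜ t (λ e → <⇒≢ (<-trans z<s 1+m<k) (sym (cong toℕ e)))
                        (λ e → <⇒≢ 1+m<k (sym (trans (cong toℕ e) (toℕ-ι (<-trans 1+m<k (toℕ<n k))))))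

  star-at : ∀ m k t → m ≤ top → toℕ k ≡ m → prodP (star m) (k , t) ≡ (zero , t)
  star-at zero k t _ k≡0 = cong (_, t) (toℕ-injective k≡0)
  star-at (suc m) k t 1+m≤top k≡1+m rewrite star-above m k t (subst (m <_) (sym k≡1+m) (n<1+n m)) =
    trans (cong (λ k → refl-ijs zero (ι (suc m)) 0ᶜ (k , t)) (trans (sym (ι-toℕ k)) (cong ι k≡1+m)))
          (trans (refl-ijs-j 0ᶜ t (λ e → ι-suc≢0 (<⇒≤ 1+m≤top) (sym e))) (cong (zero ,_) (⊖-0ᶜ t)))

  star-below : ∀ m k t → m ≤ top → toℕ k < m → prodP (star m) (k , t) ≡ (ι (suc (toℕ k)) , t)
  star-below (suc m) k t 1+m≤top k<1+m with toℕ k ≟ m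
  ... | yes k≡m rewrite star-at m k t (<⇒≤ 1+m≤top) k≡m | k≡m =
    trans (refl-ijs-i zero (ι (suc m)) 0ᶜ t) (cong (ι (suc m) ,_) (⊕-0ᶜ t))
  ... | no k≢m rewrite star-below m k t (<⇒≤ 1+m≤top) (≤∧≢⇒< (s≤s⁻¹ k<1+m) k≢m) =
    refl-ijs-other 0ᶜ t (ι-suc≢0 k≤top) (λ e → k≢m (suc-injective (trans (sym (toℕ-ι-suc k≤top)) (trans (cong toℕ e) (toℕ-ι-suc (<⇒≤ 1+m≤top))))))
    where
      k≤top : toℕ k ≤ top
      k≤top = ≤-trans (s≤s⁻¹ k<1+m) (<⇒≤ 1+m≤top)

  module Element (a : Fin N) (s : Fin d) (a≢0 : a ≢ zero) where

    w⁻¹ : Perm d N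
    w⁻¹ (k , t) =
      if toℕ k ≡ᵇ 0 then (k , t ⊖ toℕ s)
      else if toℕ k ≡ᵇ toℕ a then (k , t ⊕ toℕ s)
      else (k , t)

    data Position : Fin N → Set where
      at-zero   : Position zero
      at-a      : Position a
      elsewhere : ∀ {k} → k ≢ zero → k ≢ a → Position k

    position : ∀ k → Position k
    position k with k Fin.≟ zero | k Fin.≟ a
    ... | yes refl | _        = at-zero
    ... | no _     | yes refl = at-a
    ... | no k≢0   | no k≢a   = elsewhere k≢0 k≢a

    w-a : ∀ t → wElt a s (a , t) ≡ (a , t ⊖ toℕ s)
    w-a t rewrite ≢⇒toℕ-≡ᵇ-false a≢0 | ≡ᵇ-refl (toℕ a) = refl

    w-elsewhere : ∀ {k} t → k ≢ zero → k ≢ a → wElt a s (k , t) ≡ (k , t)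
    w-elsewhere t k≢0 k≢a rewrite ≢⇒toℕ-≡ᵇ-false k≢0 | ≢⇒toℕ-≡ᵇ-false k≢a = refl

    w⁻¹-a : ∀ t → w⁻¹ (a , t) ≡ (a , t ⊕ toℕ s)
    w⁻¹-a t rewrite ≢⇒toℕ-≡ᵇ-false a≢0 | ≡ᵇ-refl (toℕ a) = refl

    w⁻¹-elsewhere : ∀ {k} t → k ≢ zero → k ≢ a → w⁻¹ (k , t) ≡ (k , t)
    w⁻¹-elsewhere t k≢0 k≢a rewrite ≢⇒toℕ-≡ᵇ-false k≢0 | ≢⇒toℕ-≡ᵇ-false k≢a = refl

    w-index : ∀ x → proj₁ (wElt a s x) ≡ proj₁ x
    w-index (k , t) with position k
    ... | at-zero = refl
    ... | at-a = cong proj₁ (w-a t)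
    ... | elsewhere k≢0 k≢a = cong proj₁ (w-elsewhere t k≢0 k≢a)

    w⁻¹-index : ∀ x → proj₁ (w⁻¹ x) ≡ proj₁ x
    w⁻¹-index (k , t) with position k
    ... | at-zero = refl
    ... | at-a = cong proj₁ (w⁻¹-a t)
    ... | elsewhere k≢0 k≢a = cong proj₁ (w⁻¹-elsewhere t k≢0 k≢a)

    w⁻¹-w : ∀ x → w⁻¹ (wElt a s x) ≡ x
    w⁻¹-w (k , t) with position k
    ... | at-zero = cong (zero ,_) (⊕-⊖ t (toℕ s))
    ... | at-a rewrite w-a t | w⁻¹-a (t ⊖ toℕ s) = cong (a ,_) (⊖-⊕ t (toℕ s))
    ... | elsewhere k≢0 k≢a rewrite w-elsewhere t k≢0 k≢a = w⁻¹-elsewhere t k≢0 k≢a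

    w-factorization : ∀ x → refl-ijs zero a 0ᶜ (refl-ijs zero a s x) ≡ wElt a s x
    w-factorization (k , t) with position k
    ... | at-zero rewrite refl-ijs-i zero a s t | refl-ijs-j 0ᶜ (t ⊕ toℕ s) (λ e → a≢0 (sym e)) =
          cong (zero ,_) (⊖-0ᶜ (t ⊕ toℕ s))
    ... | at-a rewrite refl-ijs-j s t (λ e → a≢0 (sym e)) | refl-ijs-i zero a 0ᶜ (t ⊖ toℕ s) | w-a t =
          cong (a ,_) (⊕-0ᶜ (t ⊖ toℕ s))
    ... | elsewhere k≢0 k≢a rewrite refl-ijs-other s t k≢0 k≢a | refl-ijs-other 0ᶜ t k≢0 k≢a | w-elsewhere t k≢0 k≢a = refl

    w⁻¹γ : Perm d N
    w⁻¹γ = w⁻¹ ∘P γ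

    open WithIndicesOfγ w⁻¹γ (λ y → w⁻¹-index (γ y))

    ι-suc≢a : ∀ {j} → j ≤ top → suc j ≢ toℕ a → ι (suc j) ≢ a
    ι-suc≢a j≤top 1+j≢a e = 1+j≢a (trans (sym (toℕ-ι-suc j≤top)) (cong toℕ e))

    w⁻¹γ-step : ∀ {j} t → j < top → w⁻¹γ (ι j , t) ≡ w⁻¹ (ι (suc j) , t)
    w⁻¹γ-step t j<top = cong w⁻¹ (γ-step t j<top)

    w⁻¹γ-step-elsewhere : ∀ {j} t → j < top → suc j ≢ toℕ a → proj₂ (w⁻¹γ (ι j , t)) ≡ t
    w⁻¹γ-step-elsewhere t j<top 1+j≢a =
      cong proj₂ (trans (w⁻¹γ-step t j<top) (w⁻¹-elsewhere t (ι-suc≢0 (<⇒≤ j<top)) (ι-suc≢a (<⇒≤ j<top) 1+j≢a)))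

    transport-suc : ∀ j {t u} → transport j t ≡ u → transport (suc j) t ≡ proj₂ (w⁻¹γ (ι j , u))
    transport-suc j = cong (λ u → proj₂ (w⁻¹γ (ι j , u)))

    transport-before : ∀ j t → j < toℕ a → transport j t ≡ t
    transport-before zero t _ = refl
    transport-before (suc j) t 1+j<a =
      trans (transport-suc j (transport-before j t (<-trans (n<1+n j) 1+j<a)))
            (w⁻¹γ-step-elsewhere t (s≤s⁻¹ (≤-trans 1+j<a (s≤s⁻¹ (toℕ<n a)))) (<⇒≢ 1+j<a))

    transport-after : ∀ j t → toℕ a ≤ j → j ≤ top → transport j t ≡ t ⊕ toℕ s
    transport-after zero t a≤0 _ = contradiction (toℕ-injective (n≤0⇒n≡0 a≤0)) a≢0
    transport-after (suc j) t a≤1+j 1+j≤top = step (toℕ a ≟ suc j)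
      where
        ι-1+j≡a : toℕ a ≡ suc j → ι (suc j) ≡ a
        ι-1+j≡a a≡1+j = trans (cong ι (sym a≡1+j)) (ι-toℕ a)
        step : Dec (toℕ a ≡ suc j) → transport (suc j) t ≡ t ⊕ toℕ s
        step (yes a≡1+j) =
          trans (transport-suc j (transport-before j t (subst (j <_) (sym a≡1+j) ≤-refl)))
                (cong proj₂ (trans (w⁻¹γ-step t 1+j≤top) (trans (cong (λ k → w⁻¹ (k , t)) (ι-1+j≡a a≡1+j)) (w⁻¹-a t))))
        step (no a≢1+j) =
          trans (transport-suc j (transport-after j t (s≤s⁻¹ (≤∧≢⇒< a≤1+j a≢1+j)) (<⇒≤ 1+j≤top)))
                (w⁻¹γ-step-elsewhere _ 1+j≤top (λ e → a≢1+j (sym e)))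

    w⁻¹γ-wrap : ∀ u → proj₂ (w⁻¹γ (ι top , u)) ≡ (u ⊕ 1) ⊖ toℕ s
    w⁻¹γ-wrap u = cong (λ y → proj₂ (w⁻¹ y)) (γ-wrap u)

    w⁻¹γ-last : ∀ t → w⁻¹γ (last , t) ≡ w⁻¹ (last , t ⊖ 1)
    w⁻¹γ-last t = cong w⁻¹ (γ-last t)

    -- a lies on the cycle of γ: the twist s picked up at a is undone at 1, leaving γ's twist 1.
    a-onCycle⇒noInvariantSection : toℕ a ≤ top → NoInvariantSection w⁻¹γ
    a-onCycle⇒noInvariantSection a≤top = noInvariantSection twisted moves
      where
        twisted : ∀ t → holonomy t ≢ t
        twisted t =
          subst (_≢ t) (sym (trans (holonomy-≡ (transport-after top t a≤top ≤-refl)) (w⁻¹γ-wrap (t ⊕ toℕ s))))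
          (shifted-≢ (begin
            toℕ (((t ⊕ toℕ s) ⊕ 1) ⊖ toℕ s) % d  ≡⟨ toℕ-⊖ ((t ⊕ toℕ s) ⊕ 1) (toℕ s) ⟩
            (toℕ ((t ⊕ toℕ s) ⊕ 1) + neg (toℕ s)) % d  ≡⟨ +-congˡ (neg (toℕ s)) (toℕ-⊕ (t ⊕ toℕ s) 1) ⟩
            (toℕ (t ⊕ toℕ s) + 1 + neg (toℕ s)) % d  ≡⟨ +-congˡ (neg (toℕ s)) (+-congˡ 1 (toℕ-⊕ t (toℕ s))) ⟩
            (toℕ t + toℕ s + 1 + neg (toℕ s)) % d  ≡⟨ cong (λ z → (z + neg (toℕ s)) % d) (xy∙z≈xz∙y (toℕ t) (toℕ s) 1) ⟩
            (toℕ t + 1 + toℕ s + neg (toℕ s)) % d  ≡⟨ +-neg-cancelʳ (toℕ t + 1) (toℕ s) ⟩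
            (toℕ t + 1) % d  ∎) 1≉0)
          where open ≡-Reasoning
        last≢a : last ≢ a
        last≢a e = <⇒≢ (s≤s a≤top) (trans (cong toℕ (sym e)) (toℕ-ι {suc top} ≤-refl))
        moves : ∀ t → proj₂ (w⁻¹γ (last , t)) ≢ t
        moves t = subst (_≢ t) (sym (cong proj₂ (trans (w⁻¹γ-last t) (w⁻¹-elsewhere (t ⊖ 1) last≢0 last≢a)))) (⊖1-≢ t)

    -- a is the fixed index: the cycle is twisted by 1 - s and the fixed point by s - 1.
    a-last⇒noInvariantSection : toℕ a ≡ suc top → 1 < toℕ s → NoInvariantSection w⁻¹γ
    a-last⇒noInvariantSection a≡1+top 1<s = noInvariantSection twisted moves
      where
        twisted : ∀ t → holonomy t ≢ t
        twisted t =
          subst (_≢ t) (sym (trans (holonomy-≡ (transport-before top t (subst (top <_) (sym a≡1+top) (n<1+n top)))) (w⁻¹γ-wrap t)))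
          (shifted-≢ (trans (toℕ-⊖ (t ⊕ 1) (toℕ s))
                        (trans (+-congˡ (neg (toℕ s)) (toℕ-⊕ t 1)) (cong (_% d) (+-assoc (toℕ t) 1 (neg (toℕ s))))))
                     (1+neg≉0 1<s (toℕ<n s)))
        last≡a : last ≡ a
        last≡a = trans (cong ι (sym a≡1+top)) (ι-toℕ a)
        moves : ∀ t → proj₂ (w⁻¹γ (last , t)) ≢ t
        moves t =
          subst (_≢ t) (sym (cong proj₂ (trans (w⁻¹γ-last t) (trans (cong (λ k → w⁻¹ (k , t ⊖ 1)) last≡a) (w⁻¹-a (t ⊖ 1))))))
          (shifted-≢ (trans (toℕ-⊕ (t ⊖ 1) (toℕ s))
                        (trans (+-congˡ (toℕ s) (toℕ-⊖ t 1)) (cong (_% d) (+-assoc (toℕ t) (neg 1) (toℕ s)))))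
                     (neg1+≉0 1<s (toℕ<n s)))

    w-FactorLen : FactorLen (wElt a s) 2
    w-FactorLen = FactorLen-resp w-factorization (FactorLen-∘ (FactorLen-refl-ijs 0ᶜ 0≢a) (FactorLen-refl-ijs s 0≢a))
      where
        0≢a : zero ≢ a
        0≢a e = a≢0 (sym e)

    w-ReflLength : 1 ≤ toℕ s → ReflLength (wElt a s) 2
    w-ReflLength 1≤s = w-FactorLen , minimal
      where
        minimal : ∀ m → m < 2 → ¬ FactorLen (wElt a s) m
        minimal zero _ fl =
          shifted-≢ (toℕ-⊕ 0ᶜ (toℕ s)) (positive⇒≉0 1≤s (toℕ<n s)) (cong proj₂ (FactorLen-0 fl (zero , 0ᶜ)))
        minimal (suc zero) _ fl = FactorLen-1 fl w-index
        minimal (suc (suc m)) (s≤s (s≤s ()))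

    w∘star≗γ : toℕ a ≡ suc top → toℕ s ≡ 1 → ∀ y → wElt a s (prodP (star top) y) ≡ γ y
    w∘star≗γ a≡1+top s≡1 (k , t) with index-cases k
    ... | inj₂ refl = begin
      wElt a s (prodP (star top) (last , t))  ≡⟨ cong (wElt a s) (star-above top last t (subst (top <_) (sym (toℕ-ι ≤-refl)) (n<1+n top))) ⟩
      wElt a s (last , t)                     ≡⟨ cong (λ k → wElt a s (k , t)) last≡a ⟩
      wElt a s (a , t)                        ≡⟨ w-a t ⟩
      (a , t ⊖ toℕ s)                         ≡⟨ cong₂ (λ k c → (k , t ⊖ c)) (sym last≡a) s≡1 ⟩
      (last , t ⊖ 1)                          ≡⟨ γ-last t ⟨
      γ (last , t)                            ∎
      where
        open ≡-Reasoning
        last≡a : last ≡ a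
        last≡a = trans (cong ι (sym a≡1+top)) (ι-toℕ a)
    ... | inj₁ (j , j≤top , refl) with m≤n⇒m<n∨m≡n j≤top
    ...   | inj₂ refl = begin
      wElt a s (prodP (star top) (ι top , t))  ≡⟨ cong (wElt a s) (star-at top (ι top) t ≤-refl (toℕ-ι (m<n⇒m<1+n ≤-refl))) ⟩
      (zero , t ⊕ toℕ s)                      ≡⟨ cong (λ c → (zero , t ⊕ c)) s≡1 ⟩
      (zero , t ⊕ 1)                          ≡⟨ γ-wrap t ⟨
      γ (ι top , t)                           ∎
      where open ≡-Reasoning
    ...   | inj₁ j<top = begin
      wElt a s (prodP (star top) (ι j , t))  ≡⟨ cong (wElt a s) (star-below top (ι j) t ≤-refl (subst (_< top) (sym toℕ-ιj) j<top)) ⟩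
      wElt a s (ι (suc (toℕ (ι j))) , t)     ≡⟨ cong (λ i → wElt a s (ι (suc i) , t)) toℕ-ιj ⟩
      wElt a s (ι (suc j) , t)               ≡⟨ w-elsewhere t (ι-suc≢0 (<⇒≤ j<top)) (ι-suc≢a (<⇒≤ j<top) (λ e → <⇒≢ j<top (suc-injective (trans e a≡1+top)))) ⟩
      (ι (suc j) , t)                        ≡⟨ γ-step t j<top ⟨
      γ (ι j , t)                            ∎
      where
        open ≡-Reasoning
        toℕ-ιj : toℕ (ι j) ≡ j
        toℕ-ιj = toℕ-ι (m<n⇒m<1+n (m<n⇒m<1+n j<top))

    w⁻¹γ-noInvariantSection : 1 ≤ toℕ s → ¬ (toℕ a ≡ suc top × toℕ s ≡ 1) → NoInvariantSection w⁻¹γ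
    w⁻¹γ-noInvariantSection 1≤s bad with toℕ a ≟ suc top
    ... | no a≢1+top = a-onCycle⇒noInvariantSection (s≤s⁻¹ (≤∧≢⇒< (s≤s⁻¹ (toℕ<n a)) a≢1+top))
    ... | yes a≡1+top = a-last⇒noInvariantSection a≡1+top (≤∧≢⇒< 1≤s (λ e → bad (a≡1+top , sym e)))

  γ-FactorLen : FactorLen {d} {N} γ N
  γ-FactorLen = FactorLen-resp (w∘star≗γ (toℕ-ι ≤-refl) toℕ-1ᶜ) (FactorLen-∘ w-FactorLen star-FactorLen)
    where open Element last 1ᶜ last≢0

  γ-ReflLength : ReflLength {d} {N} γ N
  γ-ReflLength = γ-FactorLen , λ m m<N fl → <⇒≱ m<N (NoInvariantSection⇒long γ-noInvariantSection fl)

  module _ (a : Fin N) (s : Fin d) (1≤a : 1 ≤ toℕ a) (1≤s : 1 ≤ toℕ s) where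

    open Element a s (λ e → <⇒≢ 1≤a (sym (cong toℕ e)))

    ≤T-γ⇒a≡n∧s≡1 : wElt a s ≤T γ → toℕ a ≡ suc top × toℕ s ≡ 1
    ≤T-γ⇒a≡n∧s≡1 (y , w∘y≗γ , A , B , (w-A , _) , (y-B , _) , (_ , γ-minimal))
      with (toℕ a ≟ suc top) ×-dec (toℕ s ≟ 1)
    ... | yes a≡n∧s≡1 = a≡n∧s≡1
    ... | no bad = contradiction (+-mono-≤ 1≤A N≤B) (≤⇒≯ (minimal-≤ γ-minimal γ-FactorLen))
      where
        1≤A : 1 ≤ A
        1≤A = minimal-≤ (λ { zero z<s → proj₂ (w-ReflLength 1≤s) 0 z<s }) w-A
        y≗w⁻¹γ : ∀ z → y z ≡ w⁻¹γ z
        y≗w⁻¹γ z = trans (sym (w⁻¹-w (y z))) (cong w⁻¹ (w∘y≗γ z))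
        N≤B : N ≤ B
        N≤B = NoInvariantSection⇒long (w⁻¹γ-noInvariantSection 1≤s bad) (FactorLen-resp y≗w⁻¹γ y-B)

    a≡n∧s≡1⇒≤T-γ : toℕ a ≡ suc top × toℕ s ≡ 1 → wElt a s ≤T γ
    a≡n∧s≡1⇒≤T-γ (a≡1+top , s≡1) =
      prodP (star top) , w∘star≗γ a≡1+top s≡1 , 2 , top ,
      w-ReflLength 1≤s , (star-FactorLen , star-minimal) , γ-ReflLength
      where
        star-minimal : ∀ m → m < top → ¬ FactorLen (prodP (star top)) m
        star-minimal m m<top fl = proj₂ γ-ReflLength (2 + m) (s≤s (s≤s m<top))
          (FactorLen-resp (w∘star≗γ a≡1+top s≡1) (FactorLen-∘ w-FactorLen fl))

lemmaA2 : (d n : ℕ) .{{_ : NonZero d}} .{{_ : NonZero n}} → 2 ≤ d → 2 ≤ n →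
    (a : Fin n) → (s : Fin d) → 1 ≤ toℕ a → 1 ≤ toℕ s →
    (wElt a s ≤T γ) ⇔ ((toℕ a ≡ n ∸ 1) × (toℕ s ≡ 1))
lemmaA2 d _ 2≤d (s≤s (s≤s {n = top} z≤n)) a s 1≤a 1≤s =
  mk⇔ (≤T-γ⇒a≡n∧s≡1 a s 1≤a 1≤s) (a≡n∧s≡1⇒≤T-γ a s 1≤a 1≤s)
  where open CoxeterElement d top 2≤d
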